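{- Let $B\in\mathrm{Bic}(T)$, let $B_1,\dots,B_k$ be all the biclosed sets covered by $B$, and let $s_i=\lambda(B_i,B)$. For any $s_{\mathcal{D}}\in\psi(B)$, there is a unique way to express $s$ as a composition $s=s_{i_1}\circ\cdots\circ s_{i_\ell}$ of segments from $\{s_1,\dots,s_k\}$. In particular, for any $s_{\mathcal{D}},t_{\mathcal{D}'}\in\psi(B)$ with $s=t\circ t'$ for a segment $t'$, there is $\mathcal{D}''\subseteq\mathrm{Seg}(T)$ such that $t'_{\mathcal{D}''}\in\psi(B)$.
   Context: Let $T$ be a finite tree embedded in a disk so that exactly its leaves lie on the boundary, with every non-leaf vertex of degree at least $3$; the embedding gives a cyclic order of edges at each vertex. A segment is an acyclic path $(v_1,\dots,v_n)$, $n\ge2$, of pairwise distinct consecutive-adjacent vertices such that for each $1\le j\le n-2$ the edge $\{v_{j+1},v_{j+2}\}$ is immediately clockwise or counterclockwise from $\{v_j,v_{j+1}\}$ at $v_{j+1}$; $\mathrm{Seg}(T)$ is the set of segments. For segments $s_1=(v_1,\dots,v_k)$, $s_2=(v_k,\dots,v_n)$ sharing only $v_k$, $s_1\circ s_2=(v_1,\dots,v_n)$; they are composable if this is a segment; iterated compositions denote concatenation in order. $X\subseteq\mathrm{Seg}(T)$ is closed if it contains $s_1\circ s_2$ for all composable $s_1,s_2\in X$, biclosed if $X$ and its complement are closed. $\mathrm{Bic}(T)$ is the lattice of biclosed sets under inclusion; its covering relations are exactly pairs $(W,W\sqcup\{s\})$ of biclosed sets, and $\lambda(W,W\sqcup\{s\}):=s$.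 A split of a segment $t$ is a proper subsegment of $t$ sharing an endpoint with $t$; a break of $[a,c]$ is a pair $\{[a,b],[b,c]\}$ with $b$ a vertex of $[a,c]$ strictly between $a$ and $c$. $\mathcal{S}_T$ is the set of labels $s_{\mathcal{D}}=(s,\mathcal{D})$ with $s$ having $m$ breaks and $\mathcal{D}$ a set of $m$ splits of $s$ no two in the same break; $\widetilde{\lambda}(W,W\sqcup\{s\})=s_{\mathcal{D}}$ with $\mathcal{D}$ the set of splits of $s$ in $W$. For $B$ with lower covers $B_1,\dots,B_k$, $\psi(B):=\{\widetilde\lambda(W,Z): \bigwedge_{i=1}^k B_i\le W\lessdot Z\le B\}$. -}

module Defs where

open import Data.Nat using (ℕ; _≤_)
open import Data.Fin using (Fin)
open import Data.Bool using (Bool; true; false)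
open import Data.List using (List; []; _∷_; _++_; _∷ʳ_; length; reverse)
open import Data.List.Membership.Propositional using (_∈_; _∉_)
open import Data.List.Relation.Unary.Unique.Propositional using (Unique)
open import Data.List.Relation.Unary.Linked using (Linked)
open import Data.List.Relation.Unary.All using (All)
open import Data.Product using (Σ; Σ-syntax; _×_; ∃)
open import Data.Sum using (_⊎_)
open import Data.Unit using (⊤)
open import Data.Empty using (⊥)
open import Relation.Nullary using (¬_)
open import Relation.Binary.PropositionalEquality using (_≡_)
open import Function.Bundles using (_⇔_)

-- Plane trees (trees embedded in a disk with exactly the leaves on the
-- boundary), given combinatorially by a rotation system: rot v is the
-- list of neighbours of v in clockwise cyclic order.

CycNext : ∀ {A : Set} → List A → A → A → Set
CycNext r a b =
  (Σ[ xs ∈ _ ] Σ[ ys ∈ _ ] r ≡ xs ++ a ∷ b ∷ ys) ⊎ (Σ[ xs ∈ _ ] r ≡ b ∷ (xs ++ a ∷ []))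

CycAdj : ∀ {A : Set} → List A → A → A → Set
CycAdj r a b = CycNext r a b ⊎ CycNext r b a

record PlaneTree (n : ℕ) : Set where
  field
    rot        : Fin n → List (Fin n)
    rot-unique : ∀ v → Unique (rot v)
    rot-irrefl : ∀ v → v ∉ rot v
    rot-sym    : ∀ u v → v ∈ rot u → u ∈ rot v
  Adj : Fin n → Fin n → Set
  Adj u v = v ∈ rot u
  field
    connected  : ∀ u v → Σ[ ps ∈ List (Fin n) ] Linked Adj (u ∷ ps ∷ʳ v)
    acyclic    : ∀ a b c rest →
                 Unique (a ∷ b ∷ c ∷ rest) →
                 Linked Adj (a ∷ b ∷ c ∷ rest ∷ʳ a) → ⊥
    degree     : ∀ v → length (rot v) ≡ 1 ⊎ 3 ≤ length (rot v)

open PlaneTree public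

module _ {n : ℕ} (T : PlaneTree n) where

  V : Set
  V = Fin n

  Turns : List V → Set
  Turns (a ∷ b ∷ c ∷ rest) = CycAdj (rot T b) a c × Turns (b ∷ c ∷ rest)
  Turns _ = ⊤

  -- segments, as vertex sequences; a segment and its reverse denote the
  -- same segment (sets of segments below are reversal invariant)
  IsSeg : List V → Set
  IsSeg s = 2 ≤ length s × Unique s × Linked (Adj T) s × Turns s

  SegSet : Set
  SegSet = List V → Bool

  _⊆ˢ_ : SegSet → SegSet → Set
  X ⊆ˢ Y = ∀ s → X s ≡ true → Y s ≡ true

  Comp : List V → List V → List V → Set
  Comp s₁ s₂ s = Σ[ i ∈ List V ] Σ[ x ∈ V ] Σ[ r ∈ List V ]
    (s₁ ≡ i ∷ʳ x) × (s₂ ≡ x ∷ r) × (s ≡ i ++ x ∷ r)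

  IsSegSet : SegSet → Set
  IsSegSet X = (∀ s → X s ≡ true → IsSeg s) × (∀ s → X (reverse s) ≡ X s)

  Closed : SegSet → Set
  Closed X = ∀ s₁ s₂ s → IsSeg s₁ → IsSeg s₂ → IsSeg s → Comp s₁ s₂ s →
             X s₁ ≡ true → X s₂ ≡ true → X s ≡ true

  CoClosed : SegSet → Set
  CoClosed X = ∀ s₁ s₂ s → IsSeg s₁ → IsSeg s₂ → IsSeg s → Comp s₁ s₂ s →
               X s₁ ≡ false → X s₂ ≡ false → X s ≡ false

  Biclosed : SegSet → Set
  Biclosed X = IsSegSet X × Closed X × CoClosed X

  _⋖_ : SegSet → SegSet → Set
  W ⋖ Z = Biclosed W × Biclosed Z × W ⊆ˢ Z × ¬ (Z ⊆ˢ W) ×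
    (∀ Y → Biclosed Y → W ⊆ˢ Y → Y ⊆ˢ Z → ¬ (¬ (Y ⊆ˢ W) × ¬ (Z ⊆ˢ Y)))

  -- s is the label λ(W,Z) of a cover W ⋖ Z = (W, W ⊔ {s})
  Lab : SegSet → SegSet → List V → Set
  Lab W Z s = Z s ≡ true × W s ≡ false

  LowerLabel : SegSet → List V → Set
  LowerLabel B s = Σ[ Y ∈ SegSet ] (Y ⋖ B) × Lab Y B s

  IsMeetLC : SegSet → SegSet → Set
  IsMeetLC B M = Biclosed M × (∀ Y → Y ⋖ B → M ⊆ˢ Y) ×
    (∀ N → Biclosed N → (∀ Y → Y ⋖ B → N ⊆ˢ Y) → N ⊆ˢ M)

  Split : List V → List V → Set
  Split u t = IsSeg u × Σ[ w ∈ List V ] Σ[ rest ∈ List V ]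
    (w ≡ u ⊎ w ≡ reverse u) × ¬ (rest ≡ []) × (t ≡ w ++ rest ⊎ t ≡ rest ++ w)

  InPsi : SegSet → List V → SegSet → Set
  InPsi B s D = Σ[ M ∈ SegSet ] IsMeetLC B M ×
    Σ[ W ∈ SegSet ] Σ[ Z ∈ SegSet ] M ⊆ˢ W × W ⋖ Z × Z ⊆ˢ B × Lab W Z s ×
    (∀ u → (D u ≡ true) ⇔ (Split u s × W u ≡ true))

  ComposesTo : List (List V) → List V → Set
  ComposesTo [] s = ⊥
  ComposesTo (t ∷ []) s = t ≡ s
  ComposesTo (t ∷ u ∷ ts) s = Σ[ r ∈ List V ] ComposesTo (u ∷ ts) r × Comp t r s

  Decomp : SegSet → List (List V) → List V → Set
  Decomp B L s = All (LowerLabel B) L × ComposesTo L s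

-- Lemma 5.4.  For a biclosed set B of segments, call the labels s₁, …, s_k
-- of the lower covers of B its atoms.
--
-- Plan.  (1) Call c Removable from a biclosed X if c ∈ X, no cut splits c
-- into two members of X, and c cancels from compositions lying in X on
-- either side; then X ∖ c is biclosed.  (2) For biclosed M ⊆ X, every
-- segment of X ∖ M leads to a segment of X ∖ M removable from X
-- (RemovableSearch).  (3) Hence the lower covers of B are exactly the sets
-- B ∖ c with c removable, labelled by c: the atoms are the removable
-- segments (LowerCovers).  (4) An atom is never a proper initial part of
-- another atom, so factorisations into atoms are unique and the
-- factorisation of t is an initial part of that of t ∘ t′; the members of
-- B that are not composites form a biclosed set lying below every lower
-- cover, hence below their meet M (Composites).  (5) A label s in ψ(B) lies
-- in B but not in M, so it is composite, which gives the first claim.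
-- (6) For s = t ∘ t′, t′ is then composite, so it lies in B and outside M;
-- deleting removable segments outside M from B until t′ is deleted yields
-- a cover W ⋖ Z with M ⊆ W, Z ⊆ B and label t′ (Descent), the second claim.

module Submission where

open import Data.Bool using (Bool; true; false; _∧_; not) renaming (_≟_ to _≟B_)
open import Data.Empty using (⊥; ⊥-elim)
open import Data.Fin using (Fin) renaming (_≟_ to _≟F_)
open import Data.List using (List; []; _∷_; _++_; _∷ʳ_; length; reverse; map; allFin; cartesianProductWith; initLast; _∷ʳ′_)
open import Data.List.Properties using (∷-injective; ++-assoc; length-++; ∷ʳ-injective; reverse-++; unfold-reverse; reverse-involutive; length-reverse; length-tabulate; ≡-dec)
open import Data.List.Membership.Propositional using (_∈_; find; lose)
open import Data.List.Membership.Propositional.Properties using (∈-∃++; ∈-allFin; ∈-cartesianProductWith⁺; ∈-map⁺; ∈-map⁻)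
open import Data.List.Relation.Unary.All using (All; []; _∷_) renaming (map to All-map)
import Data.List.Relation.Unary.All.Properties as All
open import Data.List.Relation.Unary.Any using (Any; here; there; any?)
open import Data.List.Relation.Unary.AllPairs using ([]; _∷_)
open import Data.List.Relation.Unary.Linked using (Linked; []; [-]; _∷_) renaming (tail to Linked-tail)
open import Data.List.Relation.Unary.Unique.Propositional using (Unique)
open import Data.Nat using (ℕ; zero; suc; _≤_; _<_; z≤n; s≤s; _+_; _≤?_)
open import Data.Nat.Properties using (≤-trans; ≤-refl; n≤1+n; <-≤-trans; ≤-<-trans; +-suc; +-identityʳ; +-monoˡ-≤; +-mono-≤; +-mono-≤-<; ≤⇒≯; ≤-pred; m≤n+m)
open import Data.Product using (Σ-syntax; _×_; _,_; proj₁; proj₂)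
open import Data.Sum using (_⊎_; inj₁; inj₂; [_,_]′)
open import Data.Unit using (tt)
open import Function.Bundles using (_⇔_; mk⇔)
open import Relation.Nullary using (¬_; Dec; yes; no; does)
open import Relation.Nullary.Decidable using (dec-true; dec-false; _×-dec_; _⊎-dec_; ¬?; map′; decidable-stable)
open import Relation.Binary.PropositionalEquality using (_≡_; _≢_; refl; sym; trans; cong; cong₂; subst)

open import Defs

module _ {A : Set} where

  compare-cuts : ∀ (i₁ : List A) {x₁ r₁ i₂ x₂ r₂} → i₁ ++ x₁ ∷ r₁ ≡ i₂ ++ x₂ ∷ r₂ →
    (i₁ ≡ i₂ × x₁ ≡ x₂ × r₁ ≡ r₂) ⊎
    (Σ[ k ∈ List A ] i₂ ≡ i₁ ++ x₁ ∷ k × r₁ ≡ k ++ x₂ ∷ r₂) ⊎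
    (Σ[ k ∈ List A ] i₁ ≡ i₂ ++ x₂ ∷ k × r₂ ≡ k ++ x₁ ∷ r₁)
  compare-cuts [] {i₂ = []} refl = inj₁ (refl , refl , refl)
  compare-cuts [] {i₂ = y ∷ i₂} refl = inj₂ (inj₁ (i₂ , refl , refl))
  compare-cuts (y ∷ i₁) {i₂ = []} refl = inj₂ (inj₂ (i₁ , refl , refl))
  compare-cuts (y ∷ i₁) {i₂ = z ∷ i₂} eq with ∷-injective eq
  ... | refl , eq′ with compare-cuts i₁ eq′
  ... | inj₁ (refl , refl , refl) = inj₁ (refl , refl , refl)
  ... | inj₂ (inj₁ (k , refl , e)) = inj₂ (inj₁ (k , refl , e))
  ... | inj₂ (inj₂ (k , refl , e)) = inj₂ (inj₂ (k , refl , e))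

  ++-∷-nonempty : ∀ (k : List A) {x r} → k ++ x ∷ r ≢ []
  ++-∷-nonempty [] ()
  ++-∷-nonempty (_ ∷ _) ()

  ∷ʳ-nonempty : ∀ (k : List A) {x} → k ∷ʳ x ≢ []
  ∷ʳ-nonempty k = ++-∷-nonempty k

  cut-snoc : ∀ (i₁ : List A) {x₁ r₁ i₂ x₂} → i₁ ++ x₁ ∷ r₁ ≡ i₂ ∷ʳ x₂ → r₁ ≢ [] →
    Σ[ k ∈ List A ] r₁ ≡ k ∷ʳ x₂ × i₂ ≡ i₁ ++ x₁ ∷ k
  cut-snoc i₁ eq r≢[] with compare-cuts i₁ eq
  ... | inj₁ (_ , _ , e) = ⊥-elim (r≢[] e)
  ... | inj₂ (inj₁ (k , e₁ , e₂)) = k , e₂ , e₁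
  ... | inj₂ (inj₂ (k , e₁ , e₂)) = ⊥-elim (++-∷-nonempty k (sym e₂))

  long⇒tail-nonempty : ∀ {x : A} {r} → 2 ≤ length (x ∷ r) → r ≢ []
  long⇒tail-nonempty (s≤s ()) refl

  snoc-assoc : ∀ (i : List A) x k y → (i ++ x ∷ k) ∷ʳ y ≡ i ++ x ∷ (k ∷ʳ y)
  snoc-assoc i x k y = ++-assoc i (x ∷ k) (y ∷ [])

  mid-assoc : ∀ (i : List A) x k y r → (i ++ x ∷ k) ++ y ∷ r ≡ i ++ x ∷ (k ++ y ∷ r)
  mid-assoc i x k y r = ++-assoc i (x ∷ k) (y ∷ r)

  rev-mid : ∀ (i : List A) x r → reverse (i ++ x ∷ r) ≡ reverse r ++ x ∷ reverse i
  rev-mid i x r = trans (reverse-++ i (x ∷ r))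
    (trans (cong (_++ reverse i) (unfold-reverse x r)) (++-assoc (reverse r) (x ∷ []) (reverse i)))

  rev-snoc : ∀ (i : List A) x → reverse (i ∷ʳ x) ≡ x ∷ reverse i
  rev-snoc i x = reverse-++ i (x ∷ [])

  rev-nonempty : ∀ {i : List A} → i ≢ [] → reverse i ≢ []
  rev-nonempty {i} i≢[] e = i≢[] (trans (sym (reverse-involutive i)) (cong reverse e))

  All-middle : ∀ {P : A → Set} (a : List A) {x b} → All P (a ++ x ∷ b) → P x
  All-middle a ps with All.++⁻ʳ a ps
  ... | p ∷ _ = p

  Unique-prefix : ∀ (a : List A) {b} → Unique (a ++ b) → Unique a
  Unique-prefix [] _ = []
  Unique-prefix (x ∷ a) (p ∷ u) = All.++⁻ˡ a p ∷ Unique-prefix a u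

  Unique-suffix : ∀ (a : List A) {b} → Unique (a ++ b) → Unique b
  Unique-suffix [] u = u
  Unique-suffix (x ∷ a) (_ ∷ u) = Unique-suffix a u

  module _ {R : A → A → Set} where
    Linked-prefix : ∀ (a : List A) {b} → Linked R (a ++ b) → Linked R a
    Linked-prefix [] _ = []
    Linked-prefix (x ∷ []) _ = [-]
    Linked-prefix (x ∷ y ∷ a) (r ∷ l) = r ∷ Linked-prefix (y ∷ a) l

    Linked-suffix : ∀ (a : List A) {b} → Linked R (a ++ b) → Linked R b
    Linked-suffix [] l = l
    Linked-suffix (x ∷ a) l = Linked-suffix a (Linked-tail l)

  left≢right : ∀ (i : List A) {x r} → Unique (i ++ x ∷ r) → i ≢ [] → i ∷ʳ x ≢ x ∷ r
  left≢right [] u i≢[] e = i≢[] refl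
  left≢right (y ∷ i) (p ∷ u) i≢[] e with ∷-injective e
  ... | refl , _ = All-middle i p refl

  no-palindrome : ∀ (i : List A) {x} → Unique (i ++ x ∷ reverse i) → i ≢ [] → ⊥
  no-palindrome i u i≢[] with initLast i
  ... | [] = i≢[] refl
  ... | j ∷ʳ′ e with Unique-suffix j (subst Unique shape u)
    where
      shape : (j ∷ʳ e) ++ _ ∷ reverse (j ∷ʳ e) ≡ j ++ e ∷ _ ∷ e ∷ reverse j
      shape = trans (++-assoc j (e ∷ []) _) (cong (λ z → j ++ e ∷ _ ∷ z) (rev-snoc j e))
  ... | (_ ∷ e≢e ∷ _) ∷ _ = e≢e refl

  left-shorter : ∀ (i : List A) x r → r ≢ [] → length (i ∷ʳ x) < length (i ++ x ∷ r)
  left-shorter [] x [] r≢[] = ⊥-elim (r≢[] refl)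
  left-shorter [] x (_ ∷ _) r≢[] = s≤s (s≤s z≤n)
  left-shorter (y ∷ i) x r r≢[] = s≤s (left-shorter i x r r≢[])

  right-shorter≤ : ∀ (i : List A) x r → length (x ∷ r) ≤ length (i ++ x ∷ r)
  right-shorter≤ [] x r = ≤-refl
  right-shorter≤ (y ∷ i) x r = ≤-trans (right-shorter≤ i x r) (n≤1+n _)

  right-shorter : ∀ (i : List A) x r → i ≢ [] → length (x ∷ r) < length (i ++ x ∷ r)
  right-shorter [] x r i≢[] = ⊥-elim (i≢[] refl)
  right-shorter (y ∷ i) x r _ = s≤s (right-shorter≤ i x r)

  cuts : List A → List (List A × A × List A)
  cuts [] = []
  cuts (x ∷ r) = ([] , x , r) ∷ map (λ (i , y , r′) → (x ∷ i , y , r′)) (cuts r)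

  cuts-complete : ∀ (i : List A) x r → (i , x , r) ∈ cuts (i ++ x ∷ r)
  cuts-complete [] x r = here refl
  cuts-complete (y ∷ i) x r = there (∈-map⁺ _ (cuts-complete i x r))

  cuts-sound : ∀ s {i x r} → (i , x , r) ∈ cuts s → s ≡ i ++ x ∷ r
  cuts-sound (x ∷ r) (here refl) = refl
  cuts-sound (x ∷ r) (there m) with ∈-map⁻ _ m
  ... | _ , m′ , refl = cong (x ∷_) (cuts-sound r m′)

  Unique-length≤ : ∀ (xs ys : List A) → Unique xs → (∀ {y} → y ∈ xs → y ∈ ys) → length xs ≤ length ys
  Unique-length≤ [] ys u sub = z≤n
  Unique-length≤ (x ∷ xs) ys (x∉xs ∷ u) sub with ∈-∃++ (sub (here refl))
  ... | us , vs , refl = subst (suc (length xs) ≤_) (sym (trans (length-++ us) (+-suc (length us) (length vs))))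
          (s≤s (subst (length xs ≤_) (length-++ us) (Unique-length≤ xs (us ++ vs) u (λ m → drop-x us (sub (there m)) (distinct m x∉xs)))))
    where
      distinct : ∀ {y zs} → y ∈ zs → All (x ≢_) zs → y ≢ x
      distinct (here refl) (p ∷ _) e = p (sym e)
      distinct (there m) (_ ∷ ps) e = distinct m ps e
      drop-x : ∀ (us : List A) {vs y} → y ∈ us ++ x ∷ vs → y ≢ x → y ∈ us ++ vs
      drop-x [] (here refl) y≢x = ⊥-elim (y≢x refl)
      drop-x [] (there m) _ = m
      drop-x (u ∷ us) (here e) _ = here e
      drop-x (u ∷ us) (there m) y≢x = there (drop-x us m y≢x)

spend : ∀ {n a b k} → n < a + suc k → a < b → n < b + k
spend {a = a} {b} {k} bound a<b = ≤-trans bound (subst (_≤ b + k) (sym (+-suc a k)) (+-monoˡ-≤ k a<b))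

indicator : Bool → ℕ
indicator true = 1
indicator false = 0

count : ∀ {A : Set} → (A → Bool) → List A → ℕ
count X [] = 0
count X (u ∷ us) = indicator (X u) + count X us

module _ {A : Set} {Y X : A → Bool} (Y⊆X : ∀ u → Y u ≡ true → X u ≡ true) where

  indicator-mono : ∀ u → indicator (Y u) ≤ indicator (X u)
  indicator-mono u with Y u in e
  ... | false = z≤n
  ... | true rewrite Y⊆X u e = ≤-refl

  count-mono : ∀ us → count Y us ≤ count X us
  count-mono [] = z≤n
  count-mono (u ∷ us) = +-mono-≤ (indicator-mono u) (count-mono us)

  count-shrinks : ∀ {s} us → Y s ≡ false → X s ≡ true → s ∈ us → count Y us < count X us
  count-shrinks (u ∷ us) s∉Y s∈X (here refl) rewrite s∉Y | s∈X = s≤s (count-mono us)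
  count-shrinks (u ∷ us) s∉Y s∈X (there m) = +-mono-≤-< (indicator-mono u) (count-shrinks us s∉Y s∈X m)

module _ {n : ℕ} where

  Unique-length : ∀ (xs : List (Fin n)) → Unique xs → length xs ≤ n
  Unique-length xs u = subst (length xs ≤_) (length-tabulate {n = n} (λ z → z))
    (Unique-length≤ xs (allFin n) u (λ {y} _ → ∈-allFin y))

  listsUpTo : ℕ → List (List (Fin n))
  listsUpTo zero = [] ∷ []
  listsUpTo (suc k) = [] ∷ cartesianProductWith _∷_ (allFin n) (listsUpTo k)

  listsUpTo-complete : ∀ k (l : List (Fin n)) → length l ≤ k → l ∈ listsUpTo k
  listsUpTo-complete zero [] _ = here refl
  listsUpTo-complete (suc k) [] _ = here refl
  listsUpTo-complete (suc k) (x ∷ l) (s≤s le) = there (∈-cartesianProductWith⁺ _∷_ (∈-allFin x) (listsUpTo-complete k l le))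

true≢false : ∀ {a} → a ≡ true → a ≡ false → ⊥
true≢false refl ()

true-or-false : ∀ a → a ≡ true ⊎ a ≡ false
true-or-false true = inj₁ refl
true-or-false false = inj₂ refl

¬true⇒false : ∀ {a} → ¬ a ≡ true → a ≡ false
¬true⇒false {true} h = ⊥-elim (h refl)
¬true⇒false {false} _ = refl

¬false⇒true : ∀ {a} → ¬ a ≡ false → a ≡ true
¬false⇒true {true} _ = refl
¬false⇒true {false} h = ⊥-elim (h refl)

∧-true⁻ : ∀ {a b} → a ∧ b ≡ true → a ≡ true × b ≡ true
∧-true⁻ {true} {true} refl = refl , refl

∧-true⁺ : ∀ {a b} → a ≡ true → b ≡ true → a ∧ b ≡ true
∧-true⁺ refl refl = refl

not-true⁻ : ∀ {a} → not a ≡ true → a ≡ false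
not-true⁻ {false} refl = refl

bool-ext : ∀ {a b : Bool} → (a ≡ true → b ≡ true) → (b ≡ true → a ≡ true) → a ≡ b
bool-ext {true} f _ = sym (f refl)
bool-ext {false} {true} _ g = ⊥-elim (true≢false (g refl) refl)
bool-ext {false} {false} _ _ = refl

stable-true : ∀ {a} → ¬ ¬ a ≡ true → a ≡ true
stable-true h = ¬false⇒true λ f → h λ t → true≢false t f

does-true : ∀ {P : Set} (d : Dec P) → does d ≡ true → P
does-true (yes p) _ = p

does-cong : ∀ {P Q : Set} (p : Dec P) (q : Dec Q) → (P → Q) → (Q → P) → does p ≡ does q
does-cong p q f g = bool-ext (λ e → dec-true q (f (does-true p e))) (λ e → dec-true p (g (does-true q e)))

module Theory {n : ℕ} (T : PlaneTree n) where

  Vs : Set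
  Vs = List (V T)

  Seg : Vs → Set
  Seg = IsSeg T

  Turns-tail : ∀ {x} (l : Vs) → Turns T (x ∷ l) → Turns T l
  Turns-tail [] _ = tt
  Turns-tail (y ∷ []) _ = tt
  Turns-tail (y ∷ z ∷ l) (_ , t) = t

  Turns-prefix : ∀ (a : Vs) {b} → Turns T (a ++ b) → Turns T a
  Turns-prefix [] _ = tt
  Turns-prefix (x ∷ []) _ = tt
  Turns-prefix (x ∷ y ∷ []) _ = tt
  Turns-prefix (x ∷ y ∷ z ∷ a) (c , t) = c , Turns-prefix (y ∷ z ∷ a) t

  Turns-suffix : ∀ (a : Vs) {b} → Turns T (a ++ b) → Turns T b
  Turns-suffix [] t = t
  Turns-suffix (x ∷ a) {b} t = Turns-suffix a (Turns-tail (a ++ b) t)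

  seg-prefix : ∀ (a : Vs) {b} → Seg (a ++ b) → 2 ≤ length a → Seg a
  seg-prefix a (_ , u , l , t) le = le , Unique-prefix a u , Linked-prefix a l , Turns-prefix a t

  seg-suffix : ∀ (a : Vs) {b} → Seg (a ++ b) → 2 ≤ length b → Seg b
  seg-suffix a (_ , u , l , t) le = le , Unique-suffix a u , Linked-suffix a l , Turns-suffix a t

  seg-unique : ∀ {s} → Seg s → Unique s
  seg-unique (_ , u , _) = u

  seg-nonempty : ∀ {s} → Seg s → s ≢ []
  seg-nonempty (() , _) refl

  seg-init : ∀ {i x} → Seg (i ∷ʳ x) → i ≢ []
  seg-init {[]} (s≤s () , _) refl

  seg-tail : ∀ {x r} → Seg (x ∷ r) → r ≢ []
  seg-tail {r = []} (s≤s () , _) refl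

  seg-left : ∀ i {x r} → Seg (i ++ x ∷ r) → i ≢ [] → Seg (i ∷ʳ x)
  seg-left [] _ i≢[] = ⊥-elim (i≢[] refl)
  seg-left (y ∷ i) {x} {r} sg _ = seg-prefix (y ∷ i ∷ʳ x) (subst Seg (sym (++-assoc (y ∷ i) (x ∷ []) r)) sg)
    (s≤s (subst (1 ≤_) (sym (length-++ i {x ∷ []})) (m≤n+m 1 (length i))))

  seg-right : ∀ i {x r} → Seg (i ++ x ∷ r) → r ≢ [] → Seg (x ∷ r)
  seg-right i {r = []} _ r≢[] = ⊥-elim (r≢[] refl)
  seg-right i {r = _ ∷ _} sg _ = seg-suffix i sg (s≤s (s≤s z≤n))

  SameSeg : Vs → Vs → Set
  SameSeg c u = u ≡ c ⊎ u ≡ reverse c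

  sameSeg? : ∀ c u → Dec (SameSeg c u)
  sameSeg? c u = ≡-dec _≟F_ u c ⊎-dec ≡-dec _≟F_ u (reverse c)

  sameSeg-refl : ∀ c → SameSeg c c
  sameSeg-refl c = inj₁ refl

  sameSeg-rev : ∀ {c u} → SameSeg c u → SameSeg c (reverse u)
  sameSeg-rev (inj₁ refl) = inj₂ refl
  sameSeg-rev {c} (inj₂ refl) = inj₁ (reverse-involutive c)

  sameSeg-flip : ∀ {c u} → SameSeg c u → SameSeg (reverse c) u
  sameSeg-flip {c} (inj₁ refl) = inj₂ (sym (reverse-involutive c))
  sameSeg-flip (inj₂ refl) = inj₁ refl

  sameSeg-trans : ∀ {c u w} → SameSeg c u → SameSeg c w → SameSeg u w
  sameSeg-trans (inj₁ refl) w~c = w~c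
  sameSeg-trans (inj₂ refl) w~c = sameSeg-flip w~c

  pieces-differ : ∀ i {x r} → Unique (i ++ x ∷ r) → i ≢ [] → ¬ SameSeg (i ∷ʳ x) (x ∷ r)
  pieces-differ i u i≢[] (inj₁ e) = left≢right i u i≢[] (sym e)
  pieces-differ i {x} u i≢[] (inj₂ e) = no-palindrome i (subst (λ z → Unique (i ++ x ∷ z)) r≡ u) i≢[]
    where r≡ = proj₂ (∷-injective (trans e (rev-snoc i x)))

  _∖_ : SegSet T → Vs → SegSet T
  (X ∖ c) u = X u ∧ not (does (sameSeg? c u))

  ∖-⊆ : ∀ X c {u} → (X ∖ c) u ≡ true → X u ≡ true
  ∖-⊆ X c e = proj₁ (∧-true⁻ e)

  ∖-keeps : ∀ X c {u} → X u ≡ true → ¬ SameSeg c u → (X ∖ c) u ≡ true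
  ∖-keeps X c {u} xu ¬same = ∧-true⁺ xu (cong not (dec-false (sameSeg? c u) ¬same))

  ∖-removes : ∀ X c {u} → SameSeg c u → (X ∖ c) u ≡ false
  ∖-removes X c {u} same rewrite dec-true (sameSeg? c u) same with X u
  ... | true = refl
  ... | false = refl

  ∖-drops : ∀ X c {u} → X u ≡ true → (X ∖ c) u ≡ false → SameSeg c u
  ∖-drops X c {u} xu e with sameSeg? c u
  ... | yes same = same
  ... | no ¬same = ⊥-elim (true≢false (∖-keeps X c xu ¬same) e)

  ∖-false : ∀ X c {u} → X u ≡ false → (X ∖ c) u ≡ false
  ∖-false X c e rewrite e = refl

  ∖-flip : ∀ X c u → (X ∖ reverse c) u ≡ (X ∖ c) u
  ∖-flip X c u = cong (λ b → X u ∧ not b) (does-cong (sameSeg? (reverse c) u) (sameSeg? c u)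
    (λ s → subst (λ z → SameSeg z u) (reverse-involutive c) (sameSeg-flip s)) sameSeg-flip)

  ∖-same : ∀ X {s c} → SameSeg s c → ∀ u → (X ∖ c) u ≡ (X ∖ s) u
  ∖-same X (inj₁ refl) u = refl
  ∖-same X {s} (inj₂ refl) u = ∖-flip X s u

  ∖-reverse : ∀ X c u → X (reverse u) ≡ X u → (X ∖ c) (reverse u) ≡ (X ∖ c) u
  ∖-reverse X c u inv = cong₂ (λ a b → a ∧ not b) inv (does-cong (sameSeg? c (reverse u)) (sameSeg? c u)
    (λ s → subst (SameSeg c) (reverse-involutive u) (sameSeg-rev s)) sameSeg-rev)

  -- Conditions under which c can be deleted from a biclosed set X with the
  -- result still biclosed (removal-biclosed below).

  Unsplit : SegSet T → Vs → Set
  Unsplit X c = ∀ i x r → c ≡ i ++ x ∷ r → i ≢ [] → r ≢ [] → X (i ∷ʳ x) ≡ true → X (x ∷ r) ≡ false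

  LeftCancel : SegSet T → Vs → Set
  LeftCancel X c = ∀ i x r → c ≡ i ∷ʳ x → r ≢ [] → X (i ++ x ∷ r) ≡ true → X (x ∷ r) ≡ true

  record Removable (X : SegSet T) (c : Vs) : Set where
    field
      member  : X c ≡ true
      unsplit : Unsplit X c
      cancelˡ : LeftCancel X c
      -- i.e. c cancels on the right: t ∘ c ∈ X forces t ∈ X (cancel-right-factor)
      cancelʳ : LeftCancel X (reverse c)
  open Removable public

  module BiclosedSet {X : SegSet T} (bX : Biclosed T X) where

    member-seg : ∀ {s} → X s ≡ true → Seg s
    member-seg = proj₁ (proj₁ bX) _

    reverse-inv : ∀ s → X (reverse s) ≡ X s
    reverse-inv = proj₂ (proj₁ bX)

    reverse-inv′ : ∀ {s t} → t ≡ reverse s → X t ≡ X s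
    reverse-inv′ {s} refl = reverse-inv s

    sameSeg-member : ∀ {c u} → SameSeg c u → X u ≡ X c
    sameSeg-member (inj₁ refl) = refl
    sameSeg-member {c} (inj₂ refl) = reverse-inv c

    below-removal : ∀ {Y s} → _⊆ˢ_ T X Y → X s ≡ false → _⊆ˢ_ T X (Y ∖ s)
    below-removal {Y} {s} X⊆Y s∉X u u∈X =
      ∖-keeps Y s (X⊆Y u u∈X) λ same → true≢false (trans (sym (sameSeg-member same)) u∈X) s∉X

    closed-at : ∀ i x r → Seg (i ++ x ∷ r) → i ≢ [] → r ≢ [] →
      X (i ∷ʳ x) ≡ true → X (x ∷ r) ≡ true → X (i ++ x ∷ r) ≡ true
    closed-at i x r sg i≢[] r≢[] =
      proj₁ (proj₂ bX) _ _ _ (seg-left i sg i≢[]) (seg-right i sg r≢[]) sg (i , x , r , refl , refl , refl)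

    coclosed-at : ∀ i x r → Seg (i ++ x ∷ r) → i ≢ [] → r ≢ [] →
      X (i ∷ʳ x) ≡ false → X (x ∷ r) ≡ false → X (i ++ x ∷ r) ≡ false
    coclosed-at i x r sg i≢[] r≢[] =
      proj₂ (proj₂ bX) _ _ _ (seg-left i sg i≢[]) (seg-right i sg r≢[]) sg (i , x , r , refl , refl , refl)

    unsplit-rev : ∀ {c} → Unsplit X c → Unsplit X (reverse c)
    unsplit-rev {c} us i x r e i≢[] r≢[] left = ¬true⇒false λ right →
      true≢false (trans (reverse-inv′ (sym (rev-snoc i x))) left)
        (us (reverse r) x (reverse i) c≡ (rev-nonempty r≢[]) (rev-nonempty i≢[])
          (trans (reverse-inv′ (sym (unfold-reverse x r))) right))
      where c≡ = trans (sym (reverse-involutive c)) (trans (cong reverse e) (rev-mid i x r))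

    removable-rev : ∀ {c} → Removable X c → Removable X (reverse c)
    removable-rev {c} rc = record
      { member  = trans (reverse-inv c) (member rc)
      ; unsplit = unsplit-rev (unsplit rc)
      ; cancelˡ = cancelʳ rc
      ; cancelʳ = subst (LeftCancel X) (sym (reverse-involutive c)) (cancelˡ rc) }

    removable-same : ∀ {c u} → Removable X c → SameSeg c u → Removable X u
    removable-same rc (inj₁ refl) = rc
    removable-same rc (inj₂ refl) = removable-rev rc

    cancel-right-factor : ∀ {x r} → Removable X (x ∷ r) → ∀ i → i ≢ [] →
      X (i ++ x ∷ r) ≡ true → X (i ∷ʳ x) ≡ true
    cancel-right-factor {x} {r} rc i i≢[] w∈ = trans (sym (reverse-inv′ (sym (rev-snoc i x))))
      (cancelʳ rc (reverse r) x (reverse i) (unfold-reverse x r) (rev-nonempty i≢[])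
        (trans (reverse-inv′ (sym (rev-mid i x r))) w∈))

    removal-closed : ∀ {c} → Removable X c → Closed T (X ∖ c)
    removal-closed {c} rc _ _ _ sg₁ sg₂ sg (i , x , r , refl , refl , refl) a b =
      ∖-keeps X c (closed-at i x r sg i≢[] r≢[] l∈ r∈) λ same →
        true≢false r∈ (unsplit (removable-same rc same) i x r refl i≢[] r≢[] l∈)
      where
        i≢[] = seg-init sg₁
        r≢[] = seg-tail sg₂
        l∈ = ∖-⊆ X c a
        r∈ = ∖-⊆ X c b

    removal-coclosed : ∀ {c} → Removable X c → CoClosed T (X ∖ c)
    removal-coclosed {c} rc _ _ _ sg₁ sg₂ sg (i , x , r , refl , refl , refl) a b
      with true-or-false (X (i ∷ʳ x)) | true-or-false (X (x ∷ r))
    ... | inj₂ l∉ | inj₂ r∉ = ∖-false X c (coclosed-at i x r sg (seg-init sg₁) (seg-tail sg₂) l∉ r∉)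
    ... | inj₁ l∈ | inj₂ r∉ = ∖-false X c (¬true⇒false λ w∈ →
          true≢false (cancelˡ (removable-same rc (∖-drops X c l∈ a)) i x r refl (seg-tail sg₂) w∈) r∉)
    ... | inj₂ l∉ | inj₁ r∈ = ∖-false X c (¬true⇒false λ w∈ →
          true≢false (cancel-right-factor (removable-same rc (∖-drops X c r∈ b)) i (seg-init sg₁) w∈) l∉)
    ... | inj₁ l∈ | inj₁ r∈ = ⊥-elim (pieces-differ i (seg-unique sg) (seg-init sg₁)
          (sameSeg-trans (∖-drops X c l∈ a) (∖-drops X c r∈ b)))

    removal-biclosed : ∀ {c} → Removable X c → Biclosed T (X ∖ c)
    removal-biclosed {c} rc = ((λ s e → member-seg (∖-⊆ X c e)) , (λ u → ∖-reverse X c u (reverse-inv u))) ,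
      removal-closed rc , removal-coclosed rc

  SplitsInto : SegSet T → Vs → Set
  SplitsInto X c = Σ[ i ∈ Vs ] Σ[ x ∈ V T ] Σ[ r ∈ Vs ]
    c ≡ i ++ x ∷ r × i ≢ [] × r ≢ [] × X (i ∷ʳ x) ≡ true × X (x ∷ r) ≡ true

  unsplit? : ∀ X c → SplitsInto X c ⊎ Unsplit X c
  unsplit? X c with any? splitAt? (cuts c)
    where
      SplitAt : Vs × V T × Vs → Set
      SplitAt (i , x , r) = i ≢ [] × r ≢ [] × X (i ∷ʳ x) ≡ true × X (x ∷ r) ≡ true
      splitAt? : ∀ cut → Dec (SplitAt cut)
      splitAt? (i , x , r) = ¬? (≡-dec _≟F_ i []) ×-dec ¬? (≡-dec _≟F_ r []) ×-dec
                             X (i ∷ʳ x) ≟B true ×-dec X (x ∷ r) ≟B true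
  ... | yes p with find p
  ...   | (i , x , r) , m , split = inj₁ (i , x , r , cuts-sound c m , split)
  unsplit? X c | no ¬p = inj₂ λ i x r e i≢[] r≢[] left → ¬true⇒false λ right →
    ¬p (lose (subst (λ z → (i , x , r) ∈ cuts z) (sym e) (cuts-complete i x r)) (i≢[] , r≢[] , left , right))

  LeftCancelFails : SegSet T → Vs → Set
  LeftCancelFails X c = Σ[ i ∈ Vs ] Σ[ x ∈ V T ] Σ[ r ∈ Vs ]
    c ≡ i ∷ʳ x × r ≢ [] × X (i ++ x ∷ r) ≡ true × X (x ∷ r) ≡ false

  module Decisions {X : SegSet T} (bX : Biclosed T X) where
    open BiclosedSet bX

    -- Decidable because the possible extensions are segments, hence have
    -- at most n vertices and can be enumerated.
    leftCancel? : ∀ c → c ≢ [] → LeftCancelFails X c ⊎ LeftCancel X c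
    leftCancel? c c≢[] with initLast c
    ... | [] = ⊥-elim (c≢[] refl)
    ... | i ∷ʳ′ x with any? (λ r → ¬? (≡-dec _≟F_ r []) ×-dec X (i ++ x ∷ r) ≟B true ×-dec X (x ∷ r) ≟B false)
                            (listsUpTo n)
    ...   | yes p with find p
    ...     | r , _ , r≢[] , w∈ , r∉ = inj₁ (i , x , r , refl , r≢[] , w∈ , r∉)
    leftCancel? c c≢[] | i ∷ʳ′ x | no ¬p = inj₂ cancels
      where
        cancels : LeftCancel X (i ∷ʳ x)
        cancels i′ x′ r e r≢[] w∈ with ∷ʳ-injective i′ i (sym e)
        ... | refl , refl = ¬false⇒true λ r∉ → ¬p (lose (listsUpTo-complete n r r-short) (r≢[] , w∈ , r∉))
          where
            r-short : length r ≤ n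
            r-short with Unique-suffix i (seg-unique (member-seg w∈))
            ... | _ ∷ u = Unique-length r u

    removable? : ∀ c → Dec (Removable X c)
    removable? c with true-or-false (X c)
    ... | inj₂ c∉ = no λ rc → true≢false (member rc) c∉
    ... | inj₁ c∈ with unsplit? X c | leftCancel? c c≢[] | leftCancel? (reverse c) (rev-nonempty c≢[])
      where c≢[] = seg-nonempty (member-seg c∈)
    ... | inj₁ (i , x , r , e , i≢[] , r≢[] , l∈ , r∈) | _ | _ = no λ rc → true≢false r∈ (unsplit rc i x r e i≢[] r≢[] l∈)
    ... | inj₂ _ | inj₁ (i , x , r , e , r≢[] , w∈ , r∉) | _ = no λ rc → true≢false (cancelˡ rc i x r e r≢[] w∈) r∉
    ... | inj₂ _ | inj₂ _ | inj₁ (i , x , r , e , r≢[] , w∈ , r∉) = no λ rc → true≢false (cancelʳ rc i x r e r≢[] w∈) r∉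
    ... | inj₂ us | inj₂ lc | inj₂ lc′ = yes record { member = c∈ ; unsplit = us ; cancelˡ = lc ; cancelʳ = lc′ }

  -- Given biclosed M ⊆ X, every segment of
  -- X ∖ M leads to a segment of X ∖ M that is removable from X: first pass
  -- to pieces until the candidate is unsplit, then, while LeftCancel fails
  -- on either side, pass to a strictly longer unsplit candidate.  Lengths
  -- of segments are bounded by n, so this terminates.
  module RemovableSearch {X M : SegSet T} (bX : Biclosed T X) (bM : Biclosed T M) (M⊆X : _⊆ˢ_ T M X) where
    open BiclosedSet bX
    private module M = BiclosedSet bM

    Candidate : Vs → Set
    Candidate s = X s ≡ true × M s ≡ false

    -- The pieces of a candidate split in X cannot both lie in M.
    smaller-candidate : ∀ {t} → Candidate t → SplitsInto X t →
      Σ[ s ∈ Vs ] Candidate s × length s < length t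
    smaller-candidate (t∈ , t∉M) (i , x , r , refl , i≢[] , r≢[] , l∈ , r∈)
      with true-or-false (M (i ∷ʳ x)) | true-or-false (M (x ∷ r))
    ... | inj₂ l∉M | _ = i ∷ʳ x , (l∈ , l∉M) , left-shorter i x r r≢[]
    ... | inj₁ _ | inj₂ r∉M = x ∷ r , (r∈ , r∉M) , right-shorter i x r i≢[]
    ... | inj₁ l∈M | inj₁ r∈M = ⊥-elim (true≢false (M.closed-at i x r (member-seg t∈) i≢[] r≢[] l∈M r∈M) t∉M)

    unsplit-candidate : ∀ k t → length t ≤ k → Candidate t → Σ[ s ∈ Vs ] Candidate s × Unsplit X s
    unsplit-candidate k t le c with unsplit? X t
    ... | inj₂ us = t , c , us
    unsplit-candidate zero [] _ (t∈ , _) | inj₁ _ = ⊥-elim (seg-nonempty (member-seg t∈) refl)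
    unsplit-candidate (suc k) t le c | inj₁ sp with smaller-candidate c sp
    ... | s , cs , shorter = unsplit-candidate k s (≤-pred (<-≤-trans shorter le)) cs

    extend-candidate : ∀ j i x r → length r ≤ j → Candidate (i ∷ʳ x) → Unsplit X (i ∷ʳ x) → r ≢ [] →
      X (i ++ x ∷ r) ≡ true → X (x ∷ r) ≡ false →
      Σ[ w ∈ Vs ] Candidate w × Unsplit X w × length (i ∷ʳ x) < length w
    extend-candidate j i x r le (c∈ , c∉M) us r≢[] w∈ r∉ with unsplit? X (i ++ x ∷ r)
    ... | inj₂ us′ = i ++ x ∷ r , (w∈ , w∉M) , us′ , left-shorter i x r r≢[]
      where
        w∉M = M.coclosed-at i x r (member-seg w∈) (seg-init (member-seg c∈)) r≢[] c∉M
                (¬true⇒false λ r∈M → true≢false (M⊆X _ r∈M) r∉)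
    ... | inj₁ (i′ , x′ , r′ , e , i′≢[] , r′≢[] , l′∈ , r′∈) with compare-cuts i e
    ...   | inj₁ (refl , refl , refl) = ⊥-elim (true≢false r′∈ r∉)
    -- the cut lies inside c: as c is unsplit, co-closure puts the right piece outside X
    ...   | inj₂ (inj₂ (k , refl , refl)) = ⊥-elim (true≢false r′∈
            (coclosed-at (x′ ∷ k) x r (member-seg r′∈) (λ ()) r≢[]
              (us i′ x′ (k ∷ʳ x) (snoc-assoc i′ x′ k x) i′≢[] (∷ʳ-nonempty k) l′∈) r∉))
    -- the cut lies inside r: recurse on the shorter extension x ∷ k ∷ʳ x′
    ...   | inj₂ (inj₁ (k , refl , refl)) with true-or-false (X (x ∷ k ∷ʳ x′))
    ...     | inj₁ q∈ = ⊥-elim (true≢false (closed-at (x ∷ k) x′ r′ (seg-right i (member-seg w∈) r≢[]) (λ ()) r′≢[] q∈ r′∈) r∉)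
    ...     | inj₂ q∉ with j
    ...       | zero = ⊥-elim (≤⇒≯ le (≤-<-trans z≤n (left-shorter k x′ r′ r′≢[])))
    ...       | suc j′ = extend-candidate j′ i x (k ∷ʳ x′) (≤-pred (<-≤-trans (left-shorter k x′ r′ r′≢[]) le))
                  (c∈ , c∉M) us (∷ʳ-nonempty k) (subst (λ z → X z ≡ true) (++-assoc i (x ∷ k) (x′ ∷ [])) l′∈) q∉

    -- Each failure of LeftCancel (on either side) yields a longer unsplit
    -- candidate; since segments have at most n vertices, a removable one is
    -- reached within k steps whenever n < length s + k.
    removable-candidate : ∀ k s → n < length s + k → Candidate s → Unsplit X s →
      Σ[ s′ ∈ Vs ] Candidate s′ × Removable X s′
    removable-candidate zero s bound (s∈ , _) _ =
      ⊥-elim (≤⇒≯ (Unique-length s (seg-unique (member-seg s∈))) (subst (n <_) (+-identityʳ (length s)) bound))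
    removable-candidate (suc k) s bound (s∈ , s∉M) us with Decisions.leftCancel? bX s (seg-nonempty (member-seg s∈))
    ... | inj₁ (i , x , r , refl , r≢[] , w∈ , r∉) with extend-candidate (length r) i x r ≤-refl (s∈ , s∉M) us r≢[] w∈ r∉
    ...   | w , cw , uw , longer = removable-candidate k w (spend bound longer) cw uw
    removable-candidate (suc k) s bound (s∈ , s∉M) us | inj₂ lc
      with Decisions.leftCancel? bX (reverse s) (rev-nonempty (seg-nonempty (member-seg s∈)))
    ... | inj₂ lc′ = s , (s∈ , s∉M) , record { member = s∈ ; unsplit = us ; cancelˡ = lc ; cancelʳ = lc′ }
    ... | inj₁ (i , x , r , e , r≢[] , w∈ , r∉)
      with extend-candidate (length r) i x r ≤-refl
             (subst (λ z → X z ≡ true) e (trans (reverse-inv s) s∈) , subst (λ z → M z ≡ false) e (trans (M.reverse-inv s) s∉M))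
             (subst (Unsplit X) e (unsplit-rev us)) r≢[] w∈ r∉
    ...   | w , cw , uw , longer = removable-candidate k w (spend bound (subst (_< length w) length≡ longer)) cw uw
      where length≡ = trans (cong length (sym e)) (length-reverse s)

    find-removable : ∀ {t} → Candidate t → Σ[ s ∈ Vs ] Candidate s × Removable X s
    find-removable {t} c with unsplit-candidate (length t) t ≤-refl c
    ... | s , cs , us = removable-candidate (suc n) s (m≤n+m (suc n) (length s)) cs us

  module LowerCovers {B : SegSet T} (bB : Biclosed T B) where
    open BiclosedSet bB

    removable⇒cover : ∀ {c} → Removable B c → _⋖_ T (B ∖ c) B
    removable⇒cover {c} rc = removal-biclosed rc , bB , (λ u → ∖-⊆ B c) ,
        (λ B⊆ → true≢false (B⊆ c (member rc)) (∖-removes B c (sameSeg-refl c))) , nothing-between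
      where
        nothing-between : ∀ Y → Biclosed T Y → _⊆ˢ_ T (B ∖ c) Y → _⊆ˢ_ T Y B →
          ¬ (¬ _⊆ˢ_ T Y (B ∖ c) × ¬ _⊆ˢ_ T B Y)
        nothing-between Y bY below above (¬Y⊆ , ¬B⊆) with true-or-false (Y c)
        ... | inj₁ c∈Y = ¬B⊆ λ u u∈B → case (sameSeg? c u) u∈B
          where
            case : ∀ {u} → Dec (SameSeg c u) → B u ≡ true → Y u ≡ true
            case (yes same) _ = trans (BiclosedSet.sameSeg-member bY same) c∈Y
            case (no ¬same) u∈B = below _ (∖-keeps B c u∈B ¬same)
        ... | inj₂ c∉Y = ¬Y⊆ (BiclosedSet.below-removal bY above c∉Y)

    removable⇒lowerLabel : ∀ {c} → Removable B c → LowerLabel T B c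
    removable⇒lowerLabel {c} rc = B ∖ c , removable⇒cover rc , member rc , ∖-removes B c (sameSeg-refl c)

    cover-labelled : ∀ {Y} → _⋖_ T Y B → ¬ ¬ (Σ[ c ∈ Vs ] Lab T Y B c)
    cover-labelled (_ , _ , _ , ¬B⊆Y , _) none =
      ¬B⊆Y λ v v∈B → stable-true λ v∉Y → none (v , v∈B , ¬true⇒false v∉Y)

    squeeze : ∀ {Y Z} → _⋖_ T Y B → Biclosed T Z → _⊆ˢ_ T Y Z → _⊆ˢ_ T Z B → ¬ _⊆ˢ_ T B Z → _⊆ˢ_ T Z Y
    squeeze (_ , _ , _ , _ , between) bZ Y⊆Z Z⊆B ¬B⊆Z u u∈Z =
      stable-true λ u∉Y → between _ bZ Y⊆Z Z⊆B ((λ Z⊆Y → u∉Y (Z⊆Y u u∈Z)) , ¬B⊆Z)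

    -- Conversely, the label c of a lower cover Y is removable and Y = B ∖ c:
    -- a removable s ∈ B ∖ Y exists (find-removable), and B ∖ s is squeezed.
    cover⇒removable : ∀ {Y c} → _⋖_ T Y B → Lab T Y B c → Removable B c × (∀ u → Y u ≡ (B ∖ c) u)
    cover⇒removable {Y} {c} cv@(bY , _ , Y⊆B , _) (c∈B , c∉Y)
      with RemovableSearch.find-removable bB bY Y⊆B (c∈B , c∉Y)
    ... | s , (s∈B , s∉Y) , rs = removable-same rs s~c , λ u → trans (Y≗ u) (sym (∖-same B s~c u))
      where
        Y⊆B∖s : _⊆ˢ_ T Y (B ∖ s)
        Y⊆B∖s = BiclosedSet.below-removal bY Y⊆B s∉Y
        B∖s⊆Y : _⊆ˢ_ T (B ∖ s) Y
        B∖s⊆Y = squeeze cv (removal-biclosed rs) Y⊆B∖s (λ u → ∖-⊆ B s)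
          λ B⊆ → true≢false (B⊆ s s∈B) (∖-removes B s (sameSeg-refl s))
        Y≗ : ∀ u → Y u ≡ (B ∖ s) u
        Y≗ u = bool-ext (Y⊆B∖s u) (B∖s⊆Y u)
        s~c : SameSeg s c
        s~c = ∖-drops B s c∈B (¬true⇒false λ c∈ → true≢false (B∖s⊆Y c c∈) c∉Y)

    lowerLabel⇒removable : ∀ {c} → LowerLabel T B c → Removable B c
    lowerLabel⇒removable (_ , cv , lab) = proj₁ (cover⇒removable cv lab)

  -- Compositions of atoms: the labels s₁, …, s_k of the lower covers of a
  -- biclosed set B, i.e. (by LowerCovers) the segments removable from B.
  module Composites {B : SegSet T} (bB : Biclosed T B) where
    open BiclosedSet bB
    open LowerCovers bB

    Atoms : List Vs → Set
    Atoms = All (Removable B)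

    Composite : Vs → Set
    Composite u = Σ[ L ∈ List Vs ] Atoms L × ComposesTo T L u

    composite-long : ∀ L {u} → Atoms L → ComposesTo T L u → 2 ≤ length u
    composite-long (c ∷ []) (rc ∷ _) refl = proj₁ (member-seg (member rc))
    composite-long (c ∷ d ∷ ds) (_ ∷ rs) (_ , cr , i , x , r , refl , refl , refl) =
      ≤-trans (composite-long (d ∷ ds) rs cr) (right-shorter≤ i x r)

    composite-tail : ∀ L {x r} → Atoms L → ComposesTo T L (x ∷ r) → r ≢ []
    composite-tail L {x} as cs = long⇒tail-nonempty {x = x} (composite-long L as cs)

    no-atom-prefix : ∀ {c d} i x r → Removable B c → Removable B d → c ≡ i ++ x ∷ r → d ≡ i ∷ʳ x → r ≢ [] → ⊥
    no-atom-prefix i x r rc rd refl refl r≢[] =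
      true≢false (cancelˡ rd i x r refl r≢[] (member rc))
        (unsplit rc i x r refl (seg-init (member-seg (member rd))) r≢[] (member rd))

    factorisation-unique : ∀ L₁ L₂ {u} → Atoms L₁ → Atoms L₂ → ComposesTo T L₁ u → ComposesTo T L₂ u → L₁ ≡ L₂
    factorisation-unique (c ∷ []) (d ∷ []) _ _ refl refl = refl
    factorisation-unique (c ∷ []) (d ∷ d′ ∷ ds) (rc ∷ _) (rd ∷ rs) refl (_ , cr , i , x , r , refl , refl , refl) =
      ⊥-elim (no-atom-prefix i x r rc rd refl refl (composite-tail (d′ ∷ ds) rs cr))
    factorisation-unique (c ∷ c′ ∷ cs) (d ∷ []) (rc ∷ rs) (rd ∷ _) (_ , cr , i , x , r , refl , refl , refl) refl =
      ⊥-elim (no-atom-prefix i x r rd rc refl refl (composite-tail (c′ ∷ cs) rs cr))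
    factorisation-unique (c ∷ c′ ∷ cs) (d ∷ d′ ∷ ds) (rc ∷ rs) (rd ∷ qs)
      (_ , cr₁ , i₁ , x₁ , r₁ , refl , refl , refl) (_ , cr₂ , i₂ , x₂ , r₂ , refl , refl , e) with compare-cuts i₁ e
    ... | inj₁ (refl , refl , refl) = cong (c ∷_) (factorisation-unique (c′ ∷ cs) (d′ ∷ ds) rs qs cr₁ cr₂)
    ... | inj₂ (inj₁ (k , refl , refl)) = ⊥-elim (no-atom-prefix i₁ x₁ (k ∷ʳ x₂) rd rc (snoc-assoc i₁ x₁ k x₂) refl (∷ʳ-nonempty k))
    ... | inj₂ (inj₂ (k , refl , refl)) = ⊥-elim (no-atom-prefix i₂ x₂ (k ∷ʳ x₁) rc rd (snoc-assoc i₂ x₂ k x₁) refl (∷ʳ-nonempty k))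

    -- If composites t and s satisfy s = t ∘ (x ∷ r), then x ∷ r is composite:
    -- the factorisation of t is an initial part of that of s.
    composite-residual : ∀ Lt Ls {t s} i x r → Atoms Lt → Atoms Ls → ComposesTo T Lt t → ComposesTo T Ls s →
      t ≡ i ∷ʳ x → s ≡ i ++ x ∷ r → r ≢ [] → Composite (x ∷ r)
    composite-residual (c ∷ []) (d ∷ []) i x r (rc ∷ _) (rd ∷ _) refl refl et es r≢[] =
      ⊥-elim (no-atom-prefix i x r rd rc es et r≢[])
    composite-residual (c ∷ []) (d ∷ d′ ∷ ds) i x r (rc ∷ _) (rd ∷ rs) refl (_ , cr , i₂ , x₂ , r₂ , refl , refl , refl) et es r≢[]
      with compare-cuts i (sym es)
    ... | inj₁ (refl , refl , refl) = d′ ∷ ds , rs , cr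
    ... | inj₂ (inj₁ (k , refl , refl)) = ⊥-elim (no-atom-prefix i x (k ∷ʳ x₂) rd rc (snoc-assoc i x k x₂) et (∷ʳ-nonempty k))
    ... | inj₂ (inj₂ (k , refl , refl)) = ⊥-elim (no-atom-prefix i₂ x₂ (k ∷ʳ x) rc rd (trans et (snoc-assoc i₂ x₂ k x)) refl (∷ʳ-nonempty k))
    composite-residual (c ∷ c′ ∷ cs) Ls i x r (rc ∷ rs) qs (_ , crt , i₁ , x₁ , r₁ , refl , refl , refl) crs et es r≢[]
      with cut-snoc i₁ et (composite-tail (c′ ∷ cs) rs crt)
    ... | k , refl , refl = peel Ls qs crs (trans es (mid-assoc i₁ x₁ k x r))
      where
        -- the first atom of s is c as well; continue with the remaining atoms
        peel : ∀ Ls {s} → Atoms Ls → ComposesTo T Ls s → s ≡ i₁ ++ x₁ ∷ (k ++ x ∷ r) → Composite (x ∷ r)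
        peel (d ∷ []) (rd ∷ _) refl es′ = ⊥-elim (no-atom-prefix i₁ x₁ (k ++ x ∷ r) rd rc es′ refl (++-∷-nonempty k))
        peel (d ∷ d′ ∷ ds) (rd ∷ qs′) (_ , cr , i₂ , x₂ , r₂ , refl , refl , refl) es′ with compare-cuts i₁ (sym es′)
        ... | inj₁ (refl , refl , refl) =
              composite-residual (c′ ∷ cs) (d′ ∷ ds) (x₁ ∷ k) x r rs qs′ crt cr refl refl r≢[]
        ... | inj₂ (inj₁ (k′ , refl , _)) = ⊥-elim (no-atom-prefix i₁ x₁ (k′ ∷ʳ x₂) rd rc (snoc-assoc i₁ x₁ k′ x₂) refl (∷ʳ-nonempty k′))
        ... | inj₂ (inj₂ (k′ , refl , refl)) = ⊥-elim (no-atom-prefix i₂ x₂ (k′ ∷ʳ x₁) rc rd (snoc-assoc i₂ x₂ k′ x₁) refl (∷ʳ-nonempty k′))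

    factorisation-++ : ∀ L₁ L₂ {u v w} → Atoms L₁ → ComposesTo T L₁ u → ComposesTo T L₂ v → Comp T u v w →
      ComposesTo T (L₁ ++ L₂) w
    factorisation-++ (c ∷ []) (d ∷ ds) _ refl cv cp = _ , cv , cp
    factorisation-++ (c ∷ c′ ∷ cs) L₂ (_ ∷ rs) (_ , cr , i₁ , x₁ , r₁ , refl , refl , refl) cv (i₂ , x₂ , r₂ , e , refl , refl)
      with cut-snoc i₁ e (composite-tail (c′ ∷ cs) rs cr)
    ... | k , refl , refl = x₁ ∷ k ++ x₂ ∷ r₂ ,
            factorisation-++ (c′ ∷ cs) L₂ rs cr cv (x₁ ∷ k , x₂ , r₂ , refl , refl , refl) ,
            i₁ , x₁ , k ++ x₂ ∷ r₂ , refl , refl , mid-assoc i₁ x₁ k x₂ r₂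

    composite-∘ : ∀ {u v w} → Composite u → Composite v → Comp T u v w → Composite w
    composite-∘ (L₁ , as₁ , cu) (L₂ , as₂ , cv) cp = L₁ ++ L₂ , All.++⁺ as₁ as₂ , factorisation-++ L₁ L₂ as₁ cu cv cp

    composite-reverse : ∀ {u} → Composite u → Composite (reverse u)
    composite-reverse (c ∷ [] , rc ∷ [] , refl) = reverse c ∷ [] , removable-rev rc ∷ [] , refl
    composite-reverse (c ∷ c′ ∷ cs , rc ∷ rs , _ , cr , i , x , r , refl , refl , refl) =
      composite-∘ (composite-reverse (c′ ∷ cs , rs , cr)) (reverse (i ∷ʳ x) ∷ [] , removable-rev rc ∷ [] , refl)
        (reverse r , x , reverse i , unfold-reverse x r , rev-snoc i x , rev-mid i x r)

    composite-member : ∀ L {u} → Atoms L → ComposesTo T L u → Seg u → B u ≡ true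
    composite-member (c ∷ []) (rc ∷ _) refl _ = member rc
    composite-member (c ∷ c′ ∷ cs) (rc ∷ rs) (_ , cr , i , x , r , refl , refl , refl) sg =
      closed-at i x r sg (seg-init (member-seg (member rc))) r≢[] (member rc)
        (composite-member (c′ ∷ cs) rs cr (seg-right i sg r≢[]))
      where r≢[] = composite-tail (c′ ∷ cs) rs cr

    composite-outside : ∀ {M} → Biclosed T M → ∀ L {u} → Atoms L → All (λ c → M c ≡ false) L →
      ComposesTo T L u → Seg u → M u ≡ false
    composite-outside bM (c ∷ []) _ (m ∷ _) refl _ = m
    composite-outside bM (c ∷ c′ ∷ cs) (rc ∷ rs) (m ∷ ms) (_ , cr , i , x , r , refl , refl , refl) sg =
      BiclosedSet.coclosed-at bM i x r sg (seg-init (member-seg (member rc))) r≢[] m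
        (composite-outside bM (c′ ∷ cs) rs ms cr (seg-right i sg r≢[]))
      where r≢[] = composite-tail (c′ ∷ cs) rs cr

    cancel-composite-left : ∀ L i x r → Atoms L → ComposesTo T L (i ∷ʳ x) → r ≢ [] →
      B (i ++ x ∷ r) ≡ true → B (x ∷ r) ≡ true
    cancel-composite-left (c ∷ []) i x r (rc ∷ _) refl r≢[] w∈ = cancelˡ rc i x r refl r≢[] w∈
    cancel-composite-left (c ∷ c′ ∷ cs) i x r (rc ∷ rs) (_ , cr , i₁ , x₁ , r₁ , refl , refl , e) r≢[] w∈
      with cut-snoc i₁ (sym e) (composite-tail (c′ ∷ cs) rs cr)
    ... | k , refl , refl = cancel-composite-left (c′ ∷ cs) (x₁ ∷ k) x r rs cr r≢[]
          (cancelˡ rc i₁ x₁ (k ++ x ∷ r) refl (++-∷-nonempty k) (subst (λ z → B z ≡ true) (mid-assoc i₁ x₁ k x r) w∈))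

    cancel-composite-right : ∀ L i x r → Atoms L → ComposesTo T L (x ∷ r) → i ≢ [] →
      B (i ++ x ∷ r) ≡ true → B (i ∷ʳ x) ≡ true
    cancel-composite-right (c ∷ []) i x r (rc ∷ _) refl i≢[] w∈ = cancel-right-factor rc i i≢[] w∈
    cancel-composite-right (c ∷ c′ ∷ cs) i x r (rc ∷ rs) (_ , cr , [] , x₁ , r₁ , refl , refl , e) i≢[] w∈ =
      ⊥-elim (seg-init (member-seg (member rc)) refl)
    cancel-composite-right (c ∷ c′ ∷ cs) i x r (rc ∷ rs) (_ , cr , y ∷ j , x₁ , r₁ , refl , refl , e) i≢[] w∈
      with ∷-injective e
    ... | refl , refl = cancel-right-factor rc i i≢[]
          (subst (λ z → B z ≡ true) (snoc-assoc i x j x₁)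
            (cancel-composite-right (c′ ∷ cs) (i ++ x ∷ j) x₁ r₁ rs cr (++-∷-nonempty i)
              (subst (λ z → B z ≡ true) (sym (mid-assoc i x j x₁ r₁)) w∈)))

    composite-pieces : ∀ L i x r → Atoms L → ComposesTo T L (i ++ x ∷ r) → i ≢ [] → r ≢ [] →
      B (i ∷ʳ x) ≡ true → B (x ∷ r) ≡ true → Composite (i ∷ʳ x) ⊎ Composite (x ∷ r)
    composite-pieces (c ∷ []) i x r (rc ∷ _) refl i≢[] r≢[] l∈ r∈ =
      ⊥-elim (true≢false r∈ (unsplit rc i x r refl i≢[] r≢[] l∈))
    composite-pieces (c ∷ c′ ∷ cs) i x r (rc ∷ rs) (_ , cr , i₁ , x₁ , r₁ , refl , refl , e) i≢[] r≢[] l∈ r∈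
      with compare-cuts i e
    ... | inj₁ (refl , refl , refl) = inj₁ (c ∷ [] , rc ∷ [] , refl)
    -- the cut lies inside the first atom c, which would then split into members of B
    ... | inj₂ (inj₁ (k , refl , refl)) = ⊥-elim (true≢false
            (cancel-composite-right (c′ ∷ cs) (x ∷ k) x₁ r₁ rs cr (λ ()) r∈)
            (unsplit rc i x (k ∷ʳ x₁) (snoc-assoc i x k x₁) i≢[] (∷ʳ-nonempty k) l∈))
    -- the cut lies after c: cancel c from the left piece and recurse
    ... | inj₂ (inj₂ (k , refl , refl))
      with composite-pieces (c′ ∷ cs) (x₁ ∷ k) x r rs cr (λ ()) r≢[]
             (cancelˡ rc i₁ x₁ (k ∷ʳ x) refl (∷ʳ-nonempty k) (subst (λ z → B z ≡ true) (snoc-assoc i₁ x₁ k x) l∈)) r∈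
    ...   | inj₂ composite-right = inj₂ composite-right
    ...   | inj₁ composite-left = inj₁ (composite-∘ (c ∷ [] , rc ∷ [] , refl) composite-left
              (i₁ , x₁ , k ∷ʳ x , refl , refl , snoc-assoc i₁ x₁ k x))

    atom-composite : ∀ {c} → Removable B c → Composite c
    atom-composite {c} rc = c ∷ [] , rc ∷ [] , refl

    -- Being composite is decidable: u is an atom, or it starts with an atom
    -- at some cut and the (shorter) rest is composite.
    composite-bounded? : ∀ k u → length u ≤ k → Dec (Composite u)
    composite-bounded? zero u le = no λ (L , as , cs) → ≤⇒≯ le (≤-trans (s≤s z≤n) (composite-long L as cs))
    composite-bounded? (suc k) u le with Decisions.removable? bB u
    ... | yes ru = yes (atom-composite ru)
    ... | no ¬ru with any? startsWithAtom? (cuts u)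
      where
        shortComposite? : ∀ v → Dec (length v ≤ k × Composite v)
        shortComposite? v with length v ≤? k
        ... | yes short = map′ (short ,_) proj₂ (composite-bounded? k v short)
        ... | no ¬short = no λ (short , _) → ¬short short
        StartsWithAtom : Vs × V T × Vs → Set
        StartsWithAtom (i , x , r) = i ≢ [] × Removable B (i ∷ʳ x) × (length (x ∷ r) ≤ k × Composite (x ∷ r))
        startsWithAtom? : ∀ cut → Dec (StartsWithAtom cut)
        startsWithAtom? (i , x , r) = ¬? (≡-dec _≟F_ i []) ×-dec Decisions.removable? bB (i ∷ʳ x) ×-dec shortComposite? (x ∷ r)
    ...   | yes p with find p
    ...     | (i , x , r) , m , _ , ra , _ , rest = yes (composite-∘ (atom-composite ra) rest (i , x , r , refl , refl , cuts-sound u m))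
    composite-bounded? (suc k) u le | no ¬ru | no ¬p = no λ where
      (c ∷ [] , rc ∷ _ , refl) → ¬ru rc
      (c ∷ d ∷ ds , rc ∷ rs , _ , cr , i , x , r , refl , refl , refl) →
        let i≢[] = seg-init (member-seg (member rc)) in
        ¬p (lose (cuts-complete i x r) (i≢[] , rc , ≤-pred (<-≤-trans (right-shorter i x r i≢[]) le) , d ∷ ds , rs , cr))

    composite? : ∀ u → Dec (Composite u)
    composite? u = composite-bounded? (length u) u ≤-refl

    Irreducible : SegSet T
    Irreducible u = B u ∧ not (does (composite? u))

    irreducible⁻ : ∀ {u} → Irreducible u ≡ true → B u ≡ true × ¬ Composite u
    irreducible⁻ {u} e with ∧-true⁻ {B u} e
    ... | u∈ , nc = u∈ , λ cu → true≢false (dec-true (composite? u) cu) (not-true⁻ nc)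

    irreducible⁺ : ∀ {u} → B u ≡ true → ¬ Composite u → Irreducible u ≡ true
    irreducible⁺ {u} u∈ ¬cu = ∧-true⁺ u∈ (cong not (dec-false (composite? u) ¬cu))

    reducible : ∀ {u} → Irreducible u ≡ false → B u ≡ true → Composite u
    reducible {u} e u∈ = decidable-stable (composite? u) λ ¬cu → true≢false (irreducible⁺ u∈ ¬cu) e

    irreducible-closed : Closed T Irreducible
    irreducible-closed _ _ _ sg₁ sg₂ sg (i , x , r , refl , refl , refl) a b =
      irreducible⁺ (closed-at i x r sg i≢[] r≢[] l∈ r∈) λ (L , as , cs) →
        [ ¬cl , ¬cr ]′ (composite-pieces L i x r as cs i≢[] r≢[] l∈ r∈)
      where
        i≢[] = seg-init sg₁
        r≢[] = seg-tail sg₂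
        l∈ = proj₁ (irreducible⁻ a)
        ¬cl = proj₂ (irreducible⁻ a)
        r∈ = proj₁ (irreducible⁻ b)
        ¬cr = proj₂ (irreducible⁻ b)

    irreducible-coclosed : CoClosed T Irreducible
    irreducible-coclosed _ _ _ sg₁ sg₂ sg (i , x , r , refl , refl , refl) a b =
      ¬true⇒false λ w∈N → contradiction (irreducible⁻ w∈N) (true-or-false (B (i ∷ʳ x))) (true-or-false (B (x ∷ r)))
      where
        i≢[] = seg-init sg₁
        r≢[] = seg-tail sg₂
        contradiction : B (i ++ x ∷ r) ≡ true × ¬ Composite (i ++ x ∷ r) →
          (B (i ∷ʳ x) ≡ true ⊎ B (i ∷ʳ x) ≡ false) → (B (x ∷ r) ≡ true ⊎ B (x ∷ r) ≡ false) → ⊥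
        contradiction (_ , ¬cw) (inj₁ l∈) (inj₁ r∈) =
          ¬cw (composite-∘ (reducible a l∈) (reducible b r∈) (i , x , r , refl , refl , refl))
        contradiction (w∈ , _) (inj₂ l∉) (inj₁ r∈) with reducible b r∈
        ... | L , as , cs = true≢false (cancel-composite-right L i x r as cs i≢[] w∈) l∉
        contradiction (w∈ , _) (inj₁ l∈) (inj₂ r∉) with reducible a l∈
        ... | L , as , cs = true≢false (cancel-composite-left L i x r as cs r≢[] w∈) r∉
        contradiction (w∈ , _) (inj₂ l∉) (inj₂ r∉) = true≢false w∈ (coclosed-at i x r sg i≢[] r≢[] l∉ r∉)

    irreducible-biclosed : Biclosed T Irreducible
    irreducible-biclosed = ((λ u e → member-seg (proj₁ (irreducible⁻ e))) , reverse-invariant) ,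
      irreducible-closed , irreducible-coclosed
      where
        reverse-invariant : ∀ u → Irreducible (reverse u) ≡ Irreducible u
        reverse-invariant u = cong₂ (λ a b → a ∧ not b) (reverse-inv u)
          (does-cong (composite? (reverse u)) (composite? u)
            (λ c → subst Composite (reverse-involutive u) (composite-reverse c)) composite-reverse)

    irreducible-below-covers : ∀ {Y} → _⋖_ T Y B → _⊆ˢ_ T Irreducible Y
    irreducible-below-covers cv u u∈N with irreducible⁻ u∈N
    ... | u∈B , ¬cu = stable-true λ u∉Y → cover-labelled cv λ (c , lab) →
          let rc , Y≗ = cover⇒removable cv lab in
          u∉Y (trans (Y≗ u) (∖-keeps B c u∈B λ same → ¬cu (atom-composite (removable-same rc same))))

  ProperEnd : Vs → Vs → Set
  ProperEnd w t = Σ[ rest ∈ Vs ] ¬ rest ≡ [] × (t ≡ w ++ rest ⊎ t ≡ rest ++ w)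

  properEnd? : ∀ w t → Dec (ProperEnd w t)
  properEnd? w t = map′ from to (any? (λ (i , x , r) → ≡-dec _≟F_ i w ⊎-dec ≡-dec _≟F_ r w) (cuts t))
    where
      EndsAt : Vs × V T × Vs → Set
      EndsAt (i , x , r) = i ≡ w ⊎ r ≡ w
      from : Any EndsAt (cuts t) → ProperEnd w t
      from p with find p
      ... | (i , x , r) , m , inj₁ refl = x ∷ r , (λ ()) , inj₁ (cuts-sound t m)
      ... | (i , x , r) , m , inj₂ refl = i ∷ʳ x , ∷ʳ-nonempty i , inj₂ (trans (cuts-sound t m) (sym (++-assoc i (x ∷ []) r)))
      to : ProperEnd w t → Any EndsAt (cuts t)
      to ([] , rest≢[] , _) = ⊥-elim (rest≢[] refl)
      to (x ∷ r , _ , inj₁ refl) = lose (cuts-complete w x r) (inj₁ refl)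
      to (rest , rest≢[] , inj₂ refl) with initLast rest
      ... | [] = ⊥-elim (rest≢[] refl)
      ... | i ∷ʳ′ x = lose (subst (λ z → (i , x , w) ∈ cuts z) (sym (++-assoc i (x ∷ []) w)) (cuts-complete i x w)) (inj₂ refl)

  -- The combinatorial part of Split u t (Split T u t = IsSeg T u × SplitShape u t).
  SplitShape : Vs → Vs → Set
  SplitShape u t = Σ[ w ∈ Vs ] Σ[ rest ∈ Vs ] (w ≡ u ⊎ w ≡ reverse u) × ¬ (rest ≡ []) × (t ≡ w ++ rest ⊎ t ≡ rest ++ w)

  splitShape? : ∀ u t → Dec (SplitShape u t)
  splitShape? u t = map′ from to (properEnd? u t ⊎-dec properEnd? (reverse u) t)
    where
      from : ProperEnd u t ⊎ ProperEnd (reverse u) t → SplitShape u t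
      from (inj₁ (rest , ne , e)) = u , rest , inj₁ refl , ne , e
      from (inj₂ (rest , ne , e)) = reverse u , rest , inj₂ refl , ne , e
      to : SplitShape u t → ProperEnd u t ⊎ ProperEnd (reverse u) t
      to (_ , rest , inj₁ refl , ne , e) = inj₁ (rest , ne , e)
      to (_ , rest , inj₂ refl , ne , e) = inj₂ (rest , ne , e)

  splitsIn : SegSet T → Vs → SegSet T
  splitsIn W t u = W u ∧ does (splitShape? u t)

  splitsIn-spec : ∀ {W} → Biclosed T W → ∀ t u → (splitsIn W t u ≡ true) ⇔ (Split T u t × W u ≡ true)
  splitsIn-spec bW t u = mk⇔
    (λ e → let u∈ , sp = ∧-true⁻ e in (BiclosedSet.member-seg bW u∈ , does-true (splitShape? u t) sp) , u∈)
    (λ ((_ , shape) , u∈) → ∧-true⁺ u∈ (dec-true (splitShape? u t) shape))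

  psi-from-cover : ∀ {B M W Z s} → IsMeetLC T B M → _⊆ˢ_ T M W → _⋖_ T W Z → _⊆ˢ_ T Z B → Lab T W Z s →
    InPsi T B s (splitsIn W s)
  psi-from-cover meet M⊆W cv Z⊆B lab = _ , meet , _ , _ , M⊆W , cv , Z⊆B , lab , splitsIn-spec (proj₁ cv) _

  -- A segment t ∈ B outside the meet M of the lower covers of B is a label
  -- in ψ(B): descend from B through biclosed sets X with M ⊆ X ∋ t,
  -- removing removable segments of X ∖ M, until t itself is removed.
  module Descent {B M : SegSet T} (meet : IsMeetLC T B M) {t : Vs} (t∉M : M t ≡ false) where
    private
      bM = proj₁ meet

    size : SegSet T → ℕ
    size X = count X (listsUpTo n)

    Between : SegSet T → Set
    Between X = Biclosed T X × _⊆ˢ_ T M X × _⊆ˢ_ T X B × X t ≡ true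

    descend-step : ∀ {X} → Between X →
      (Σ[ D ∈ SegSet T ] InPsi T B t D) ⊎ (Σ[ X′ ∈ SegSet T ] size X′ < size X × Between X′)
    descend-step {X} (bX , M⊆X , X⊆B , t∈X) with RemovableSearch.find-removable bX bM M⊆X (t∈X , t∉M)
    ... | s , (s∈X , s∉M) , rs with sameSeg? s t
    ...   | yes same = inj₁ (_ , psi-from-cover meet M⊆X∖s (LowerCovers.removable⇒cover bX rs) X⊆B (t∈X , ∖-removes X s same))
      where M⊆X∖s = BiclosedSet.below-removal bM M⊆X s∉M
    ...   | no ¬same = inj₂ (X ∖ s , smaller , BiclosedSet.removal-biclosed bX rs ,
              BiclosedSet.below-removal bM M⊆X s∉M , (λ u e → X⊆B u (∖-⊆ X s e)) , ∖-keeps X s t∈X ¬same)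
      where
        smaller = count-shrinks (λ u → ∖-⊆ X s) (listsUpTo n) (∖-removes X s (sameSeg-refl s)) s∈X
          (listsUpTo-complete n s (Unique-length s (seg-unique (BiclosedSet.member-seg bX s∈X))))

    descend : ∀ k {X} → size X ≤ k → Between X → Σ[ D ∈ SegSet T ] InPsi T B t D
    descend k le btw with descend-step btw
    ... | inj₁ found = found
    descend zero le _ | inj₂ (_ , smaller , _) = ⊥-elim (≤⇒≯ le (≤-<-trans z≤n smaller))
    descend (suc k) le _ | inj₂ (_ , smaller , btw′) = descend k (≤-pred (<-≤-trans smaller le)) btw′

  module ForBiclosed {B : SegSet T} (bB : Biclosed T B) where
    open LowerCovers bB
    open Composites bB

    meet-misses-atoms : ∀ {M c} → IsMeetLC T B M → Removable B c → M c ≡ false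
    meet-misses-atoms (_ , below , _) rc = ¬true⇒false λ c∈M →
      true≢false (below _ (removable⇒cover rc) _ c∈M) (∖-removes B _ (sameSeg-refl _))

    -- Labels in ψ(B) are composites of atoms: they lie in B but not in the
    -- irreducible part, which is below every lower cover, hence below M.
    psi-composite : ∀ {s D} → InPsi T B s D → Composite s
    psi-composite (M , (_ , _ , greatest) , W , Z , M⊆W , _ , Z⊆B , (s∈Z , s∉W) , _) =
      reducible (¬true⇒false λ s∈N → true≢false (M⊆W _ (greatest _ irreducible-biclosed (λ _ → irreducible-below-covers) _ s∈N)) s∉W)
        (Z⊆B _ s∈Z)

    unique-decomposition : ∀ s D → InPsi T B s D →
      Σ[ L ∈ List Vs ] Decomp T B L s × (∀ L′ → Decomp T B L′ s → L′ ≡ L)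
    unique-decomposition s D ψ with psi-composite ψ
    ... | L , as , cs = L , (All-map removable⇒lowerLabel as , cs) ,
          λ L′ (ls′ , cs′) → factorisation-unique L′ L (All-map lowerLabel⇒removable ls′) as cs′ cs

    -- For s = t ∘ t′ with s, t labels in ψ(B): t′ is composite
    -- (composite-residual), so it lies in B and outside M, and Descent applies.
    residual-in-psi : ∀ s D t D′ t′ → InPsi T B s D → InPsi T B t D′ → IsSeg T t′ → Comp T t t′ s →
      Σ[ D″ ∈ SegSet T ] InPsi T B t′ D″
    residual-in-psi s D t D′ t′ ψs@(M , meet , W , Z , M⊆W , (_ , _ , W⊆Z , _) , Z⊆B , _) ψt sg′ (i , x , r , refl , refl , refl)
      with psi-composite ψs | psi-composite ψt
    ... | Ls , as , cs | Lt , at , ct with composite-residual Lt Ls i x r at as ct cs refl refl (seg-tail sg′)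
    ...   | L′ , a′ , c′ = Descent.descend meet t′∉M (Descent.size meet t′∉M B) ≤-refl
                             (bB , M⊆B , (λ _ e → e) , composite-member L′ a′ c′ sg′)
      where
        t′∉M = composite-outside (proj₁ meet) L′ a′ (All-map (meet-misses-atoms meet) a′) c′ sg′
        M⊆B : _⊆ˢ_ T M B
        M⊆B u u∈M = Z⊆B u (W⊆Z u (M⊆W u u∈M))

lemma5p4 : ∀ {n} (T : PlaneTree n) (B : SegSet T) → Biclosed T B →
    (∀ s D → InPsi T B s D →
      Σ[ L ∈ List (List (V T)) ] Decomp T B L s × (∀ L′ → Decomp T B L′ s → L′ ≡ L))
    × (∀ s D t D′ t′ → InPsi T B s D → InPsi T B t D′ → IsSeg T t′ → Comp T t t′ s →
      Σ[ D″ ∈ SegSet T ] InPsi T B t′ D″)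
lemma5p4 T B bB = unique-decomposition , residual-in-psi
  where open Theory.ForBiclosed T bB
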